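{- For every even positive integer $n$ there exists a 3-uniform hypergraph on $n$ vertices with minimum vertex degree equal to $\binom{n-1}{2}-\binom{\lfloor \frac34 n\rfloor}{2}+c-1$, where $c=2$ if $n$ is divisible by $4$ and $c=1$ otherwise, which contains no loose Hamilton cycle.
   Context: For a 3-uniform hypergraph, the degree of a vertex $v$ is the number of edges containing $v$, and the minimum vertex degree is the minimum degree over all vertices. A loose cycle in a 3-graph is a 3-graph whose vertices can be ordered cyclically so that each edge consists of $3$ consecutive vertices and every two consecutive edges share exactly one vertex. A loose Hamilton cycle is a loose cycle spanning all vertices. -}

module Defs where

open import Data.Bool using (Bool; true; false; _∧_; if_then_else_)
open import Data.Nat using (ℕ; zero; suc; _+_; _*_; _∸_; _≤_; _<_; NonZero; _≡ᵇ_)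
open import Data.Nat.DivMod using (_mod_; _/_; _%_)
open import Data.Nat.Combinatorics using (_C_)
open import Data.Fin using (Fin)
open import Data.Fin.Subset using (Subset; ⁅_⁆; _∪_; _∩_; ∣_∣; inside; outside)
open import Data.Vec using (Vec; []; _∷_; lookup)
open import Data.List using (List; []; _∷_; _++_; map; filterᵇ; length)
open import Data.Product using (Σ; ∃; _×_; _,_)
open import Function.Definitions using (Bijective)
open import Relation.Binary.PropositionalEquality using (_≡_)

record Hypergraph3 (n : ℕ) : Set where
  field
    edge    : Subset n → Bool
    uniform : ∀ S → edge S ≡ true → ∣ S ∣ ≡ 3
open Hypergraph3 public

allSubsets : (n : ℕ) → List (Subset n)
allSubsets zero    = [] ∷ []
allSubsets (suc n) = map (outside ∷_) (allSubsets n) ++ map (inside ∷_) (allSubsets n)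

degree : ∀ {n} → Hypergraph3 n → Fin n → ℕ
degree {n} H v = length (filterᵇ (λ S → edge H S ∧ lookup S v) (allSubsets n))

MinDegreeIs : ∀ {n} → Hypergraph3 n → ℕ → Set
MinDegreeIs {n} H d = (∀ v → d ≤ degree H v) × (∃ λ v → degree H v ≡ d)

vertexAt : ∀ {n} .{{_ : NonZero n}} → (Fin n → Fin n) → ℕ → Fin n
vertexAt {n} σ i = σ (i mod n)

tripleAt : ∀ {n} .{{_ : NonZero n}} → (Fin n → Fin n) → ℕ → Subset n
tripleAt σ i = ⁅ vertexAt σ (2 * i) ⁆ ∪ (⁅ vertexAt σ (suc (2 * i)) ⁆ ∪ ⁅ vertexAt σ (2 * i + 2) ⁆)

-- A loose Hamilton cycle in H: a cyclic ordering σ of all n vertices and a number k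
-- of edges with n = 2k, such that each edge e_i = {σ(2i), σ(2i+1), σ(2i+2)} (i < k,
-- indices mod n) is an edge of H, and consecutive edges e_i, e_{i+1 mod k} share
-- exactly one vertex (note e_k = e_0 since positions are taken mod n = 2k).
LooseHamiltonCycle : ∀ {n} .{{_ : NonZero n}} → Hypergraph3 n → Set
LooseHamiltonCycle {n} H =
  Σ (Fin n → Fin n) λ σ → Bijective _≡_ _≡_ σ × Σ ℕ λ k → (n ≡ 2 * k) ×
    (∀ i → i < k → edge H (tripleAt σ i) ≡ true) ×
    (∀ i → i < k → ∣ tripleAt σ i ∩ tripleAt σ (suc i) ∣ ≡ 1)

cConst : ℕ → ℕ
cConst n = if (n % 4 ≡ᵇ 0) then 2 else 1

targetDegree : ℕ → ℕ
targetDegree n = (((n ∸ 1) C 2) ∸ (((3 * n) / 4) C 2)) + cConst n ∸ 1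

-- Write n = 4m + 2 or n = 4m + 4, let A be the first m vertices and B the remaining
-- ⌊3n/4⌋ + 1 ones. The space barrier consists of all triples meeting A together with,
-- when 4 ∣ n, the triples inside B through two fixed vertices x, y ∈ B. A vertex of A has
-- degree C(n-1,2); a vertex of B misses exactly the C(⌊3n/4⌋,2) triples inside B through
-- it and, when 4 ∣ n, gets back one of them (x and y get back |B| - 2), which gives the
-- minimum degree. A loose Hamilton cycle has n/2 edges. A vertex lies in at most two of
-- them, so labelling an edge meeting A by one of its A-vertices and by whether this vertex
-- is the last of the edge is injective: at most 2m edges meet A. At most one edge lies
-- inside B, since two cycle edges share at most one vertex. So n/2 ≤ 2m + [4 ∣ n], which
-- fails as n/2 is 2m + 1, resp. 2m + 2.
module Submission where

import Algebra.Solver.IdempotentCommutativeMonoid as ∧-Solver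
open import Data.Bool using (Bool; true; false; _∧_; _∨_; not; if_then_else_)
open import Data.Bool.Properties using (∧-zeroʳ; ∧-identityʳ; ∧-comm; T-≡; ∧-idempotentCommutativeMonoid)
open import Data.Empty using (⊥-elim)
open import Data.Fin using (Fin; zero; suc; toℕ; fromℕ<)
open import Data.Fin.Properties using (toℕ-injective; toℕ-fromℕ<; toℕ<n; fromℕ<-injective; pigeonhole)
open import Data.Fin.Subset using (Subset; ∣_∣; ⊤; ⁅_⁆; _∪_; _∩_; inside; outside) renaming (⊥ to ∅)
open import Data.Fin.Subset.Properties using (∣⊤∣≡n; ∣⁅x⁆∣≡1)
open import Data.List using (List; []; _∷_; _++_; map; filterᵇ; length)
open import Data.Nat
  using (ℕ; zero; suc; _+_; _*_; _∸_; _≤_; _<_; _<?_; z≤n; s≤s; s≤s⁻¹; _≡ᵇ_; NonZero; ≢-nonZero⁻¹; _%_; _/_)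
open import Data.Nat.Combinatorics using (_C_; nC1≡n; nCk+nC[k+1]≡[n+1]C[k+1])
open import Data.Nat.Divisibility using (_∣_; divides; n∣m*n)
open import Data.Nat.DivMod
  using (m<n⇒m%n≡m; n%n≡0; [m+n]%n≡m%n; [m+kn]%n≡m%n; m*n%n≡0; %-congˡ; /-congˡ; m*n/n≡m; +-distrib-/-∣ʳ)
open import Data.Nat.Properties
open import Data.Nat.Tactic.RingSolver using (solve-∀)
open import Data.Product using (Σ; Σ-syntax; ∃-syntax; _×_; _,_; proj₁; proj₂)
open import Data.Sum using (_⊎_; inj₁; inj₂)
open import Data.Vec using ([]; _∷_; lookup; _[_]≔_)
open import Data.Vec.Properties using (lookup-replicate; lookup∘update′; lookup-zipWith)
open import Function using (_∘_)
open import Function.Bundles using (Equivalence)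
open import Function.Definitions using (Injective)
open import Relation.Binary.PropositionalEquality
open import Relation.Nullary using (¬_; yes; no)

open import Defs

-- Subsets of Fin n

∧≡true⇒ˡ : ∀ {a b} → a ∧ b ≡ true → a ≡ true
∧≡true⇒ˡ {true} _ = refl

∧≡true⇒ʳ : ∀ {a b} → a ∧ b ≡ true → b ≡ true
∧≡true⇒ʳ {true} b≡true = b≡true

infix 7 _⊆ᵇ_

_⊆ᵇ_ : ∀ {n} → Subset n → Subset n → Bool
[]      ⊆ᵇ []      = true
(a ∷ p) ⊆ᵇ (b ∷ q) = (not a ∨ b) ∧ p ⊆ᵇ q

⊆ᵇ⇒∣p∣≤∣q∣ : ∀ {n} {p q : Subset n} → p ⊆ᵇ q ≡ true → ∣ p ∣ ≤ ∣ q ∣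
⊆ᵇ⇒∣p∣≤∣q∣ {p = []}          {[]}          _   = z≤n
⊆ᵇ⇒∣p∣≤∣q∣ {p = outside ∷ p} {outside ∷ q} p⊆q = ⊆ᵇ⇒∣p∣≤∣q∣ {p = p} p⊆q
⊆ᵇ⇒∣p∣≤∣q∣ {p = outside ∷ p} {inside ∷ q}  p⊆q = m≤n⇒m≤1+n (⊆ᵇ⇒∣p∣≤∣q∣ {p = p} p⊆q)
⊆ᵇ⇒∣p∣≤∣q∣ {p = inside ∷ p}  {inside ∷ q}  p⊆q = s≤s (⊆ᵇ⇒∣p∣≤∣q∣ {p = p} p⊆q)

⊆ᵇ-trans : ∀ {n} {p q r : Subset n} → p ⊆ᵇ q ≡ true → q ⊆ᵇ r ≡ true → p ⊆ᵇ r ≡ true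
⊆ᵇ-trans {p = []}          {[]}          {[]}          _   _   = refl
⊆ᵇ-trans {p = outside ∷ p} {outside ∷ q} {_ ∷ r}       p⊆q q⊆r = ⊆ᵇ-trans {p = p} p⊆q q⊆r
⊆ᵇ-trans {p = outside ∷ p} {inside ∷ q}  {inside ∷ r}  p⊆q q⊆r = ⊆ᵇ-trans {p = p} p⊆q q⊆r
⊆ᵇ-trans {p = inside ∷ p}  {inside ∷ q}  {inside ∷ r}  p⊆q q⊆r = ⊆ᵇ-trans {p = p} p⊆q q⊆r
⊆ᵇ-trans {p = outside ∷ p} {inside ∷ q}  {outside ∷ r} _   ()
⊆ᵇ-trans {p = inside ∷ p}  {inside ∷ q}  {outside ∷ r} _   ()
⊆ᵇ-trans {p = inside ∷ p}  {outside ∷ q} {_ ∷ r}       ()  _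

lookup⇒⊆ᵇ : ∀ {n} (p q : Subset n) → (∀ w → lookup p w ≡ true → lookup q w ≡ true) → p ⊆ᵇ q ≡ true
lookup⇒⊆ᵇ []            []            _   = refl
lookup⇒⊆ᵇ (outside ∷ p) (_ ∷ q)       p⊆q = lookup⇒⊆ᵇ p q (λ w → p⊆q (suc w))
lookup⇒⊆ᵇ (inside ∷ p)  (inside ∷ q)  p⊆q = lookup⇒⊆ᵇ p q (λ w → p⊆q (suc w))
lookup⇒⊆ᵇ (inside ∷ p)  (outside ∷ q) p⊆q with () ← p⊆q zero refl

∅⊆ᵇ : ∀ {n} (p : Subset n) → ∅ ⊆ᵇ p ≡ true
∅⊆ᵇ []      = refl
∅⊆ᵇ (_ ∷ p) = ∅⊆ᵇ p

⊆ᵇ⊤ : ∀ {n} (p : Subset n) → p ⊆ᵇ ⊤ ≡ true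
⊆ᵇ⊤ []            = refl
⊆ᵇ⊤ (outside ∷ p) = ⊆ᵇ⊤ p
⊆ᵇ⊤ (inside ∷ p)  = ⊆ᵇ⊤ p

⁅⁆⊆ᵇ : ∀ {n} (v : Fin n) (p : Subset n) → ⁅ v ⁆ ⊆ᵇ p ≡ lookup p v
⁅⁆⊆ᵇ zero    (b ∷ p) rewrite ∅⊆ᵇ p = ∧-identityʳ b
⁅⁆⊆ᵇ (suc v) (b ∷ p) = ⁅⁆⊆ᵇ v p

[]≔inside-⊆ᵇ : ∀ {n} (v : Fin n) (p q : Subset n) → (p [ v ]≔ inside) ⊆ᵇ q ≡ lookup q v ∧ p ⊆ᵇ q
[]≔inside-⊆ᵇ zero    (outside ∷ p) (b ∷ q)       = refl
[]≔inside-⊆ᵇ zero    (inside ∷ p)  (outside ∷ q) = refl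
[]≔inside-⊆ᵇ zero    (inside ∷ p)  (inside ∷ q)  = refl
[]≔inside-⊆ᵇ (suc v) (a ∷ p)       (b ∷ q) rewrite []≔inside-⊆ᵇ v p q with not a ∨ b
... | true  = refl
... | false = sym (∧-zeroʳ (lookup q v))

∣[]≔inside∣ : ∀ {n} (v : Fin n) (p : Subset n) → ∣ p [ v ]≔ inside ∣ ≡ (if lookup p v then ∣ p ∣ else suc ∣ p ∣)
∣[]≔inside∣ zero    (outside ∷ p) = refl
∣[]≔inside∣ zero    (inside ∷ p)  = refl
∣[]≔inside∣ (suc v) (outside ∷ p) = ∣[]≔inside∣ v p
∣[]≔inside∣ (suc v) (inside ∷ p)  with lookup p v | ∣[]≔inside∣ v p
... | true  | eq = cong suc eq
... | false | eq = cong suc eq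

lookup-⁅⁆-≢ : ∀ {n} {v w : Fin n} → w ≢ v → lookup ⁅ v ⁆ w ≡ false
lookup-⁅⁆-≢ {v = zero}  {zero}  w≢v = ⊥-elim (w≢v refl)
lookup-⁅⁆-≢ {v = zero}  {suc w} _   = lookup-replicate w false
lookup-⁅⁆-≢ {v = suc v} {zero}  _   = refl
lookup-⁅⁆-≢ {v = suc v} {suc w} w≢v = lookup-⁅⁆-≢ (w≢v ∘ cong suc)

lookup-⁅⁆⇒≡ : ∀ {n} {v w : Fin n} → lookup ⁅ v ⁆ w ≡ true → v ≡ w
lookup-⁅⁆⇒≡ {v = zero}  {zero}  _      = refl
lookup-⁅⁆⇒≡ {v = zero}  {suc w} ⁅0⁆∋w with () ← trans (sym (lookup-replicate w false)) ⁅0⁆∋w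
lookup-⁅⁆⇒≡ {v = suc v} {suc w} ⁅v⁆∋w = cong suc (lookup-⁅⁆⇒≡ ⁅v⁆∋w)

lookup-∪⁻ : ∀ {n} (p q : Subset n) w → lookup (p ∪ q) w ≡ true → lookup p w ≡ true ⊎ lookup q w ≡ true
lookup-∪⁻ p q w p∪q∋w with lookup p w | lookup-zipWith _∨_ w p q
... | true  | _       = inj₁ refl
... | false | p∪q≡q   = inj₂ (trans (sym p∪q≡q) p∪q∋w)

lookup-∩⁺ : ∀ {n} (p q : Subset n) w → lookup p w ≡ true → lookup q w ≡ true → lookup (p ∩ q) w ≡ true
lookup-∩⁺ p q w p∋w q∋w = trans (lookup-zipWith _∧_ w p q) (cong₂ _∧_ p∋w q∋w)

1≤∣p∣ : ∀ {n} {p : Subset n} {u} → lookup p u ≡ true → 1 ≤ ∣ p ∣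
1≤∣p∣ {p = inside ∷ p}  {zero}  _   = s≤s z≤n
1≤∣p∣ {p = inside ∷ p}  {suc u} _   = s≤s z≤n
1≤∣p∣ {p = outside ∷ p} {suc u} p∋u = 1≤∣p∣ {p = p} p∋u

2≤∣p∣ : ∀ {n} {p : Subset n} {u w} → lookup p u ≡ true → lookup p w ≡ true → u ≢ w → 2 ≤ ∣ p ∣
2≤∣p∣ {p = _ ∷ p}       {zero}  {zero}  _   _   u≢w = ⊥-elim (u≢w refl)
2≤∣p∣ {p = inside ∷ p}  {zero}  {suc w} _   p∋w _   = s≤s (1≤∣p∣ {p = p} p∋w)
2≤∣p∣ {p = inside ∷ p}  {suc u} {zero}  p∋u _   _   = s≤s (1≤∣p∣ {p = p} p∋u)
2≤∣p∣ {p = inside ∷ p}  {suc u} {suc w} p∋u _   _   = s≤s (1≤∣p∣ {p = p} p∋u)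
2≤∣p∣ {p = outside ∷ p} {suc u} {suc w} p∋u p∋w u≢w = 2≤∣p∣ {p = p} p∋u p∋w (u≢w ∘ cong suc)

finalSegment : (n a : ℕ) → Subset n
finalSegment n       zero    = ⊤
finalSegment zero    (suc a) = []
finalSegment (suc n) (suc a) = outside ∷ finalSegment n a

∣finalSegment∣ : ∀ n a → ∣ finalSegment n a ∣ ≡ n ∸ a
∣finalSegment∣ n       zero    = ∣⊤∣≡n n
∣finalSegment∣ zero    (suc a) = refl
∣finalSegment∣ (suc n) (suc a) = ∣finalSegment∣ n a

lookup-finalSegment : ∀ {n a} (v : Fin n) → a ≤ toℕ v → lookup (finalSegment n a) v ≡ true
lookup-finalSegment {a = zero}  v       _         = lookup-replicate v inside
lookup-finalSegment {a = suc a} (suc v) (s≤s a≤v) = lookup-finalSegment v a≤v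

-- Counting subsets

countᵇ : {A : Set} → (A → Bool) → List A → ℕ
countᵇ p []       = 0
countᵇ p (x ∷ xs) = if p x then suc (countᵇ p xs) else countᵇ p xs

module _ {A : Set} where

  length-filterᵇ : ∀ (p : A → Bool) xs → length (filterᵇ p xs) ≡ countᵇ p xs
  length-filterᵇ p []       = refl
  length-filterᵇ p (x ∷ xs) with p x
  ... | true  = cong suc (length-filterᵇ p xs)
  ... | false = length-filterᵇ p xs

  countᵇ-++ : ∀ (p : A → Bool) xs ys → countᵇ p (xs ++ ys) ≡ countᵇ p xs + countᵇ p ys
  countᵇ-++ p []       ys = refl
  countᵇ-++ p (x ∷ xs) ys with p x
  ... | true  = cong suc (countᵇ-++ p xs ys)
  ... | false = countᵇ-++ p xs ys

  countᵇ-map : ∀ {B : Set} (p : B → Bool) (f : A → B) xs → countᵇ p (map f xs) ≡ countᵇ (λ x → p (f x)) xs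
  countᵇ-map p f []       = refl
  countᵇ-map p f (x ∷ xs) with p (f x)
  ... | true  = cong suc (countᵇ-map p f xs)
  ... | false = countᵇ-map p f xs

  countᵇ-cong : ∀ {p q : A → Bool} → (∀ x → p x ≡ q x) → ∀ xs → countᵇ p xs ≡ countᵇ q xs
  countᵇ-cong p≗q []       = refl
  countᵇ-cong {q = q} p≗q (x ∷ xs) rewrite p≗q x with q x
  ... | true  = cong suc (countᵇ-cong p≗q xs)
  ... | false = countᵇ-cong p≗q xs

  countᵇ-none : ∀ {p : A → Bool} → (∀ x → p x ≡ false) → ∀ xs → countᵇ p xs ≡ 0
  countᵇ-none p≗false []       = refl
  countᵇ-none p≗false (x ∷ xs) rewrite p≗false x = countᵇ-none p≗false xs

  countᵇ-split : ∀ (q p : A → Bool) xs →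
    countᵇ p xs ≡ countᵇ (λ x → q x ∧ p x) xs + countᵇ (λ x → not (q x) ∧ p x) xs
  countᵇ-split q p []       = refl
  countᵇ-split q p (x ∷ xs) with q x | p x
  ... | true  | true  = cong suc (countᵇ-split q p xs)
  ... | false | true  = trans (cong suc (countᵇ-split q p xs)) (sym (+-suc _ _))
  ... | true  | false = countᵇ-split q p xs
  ... | false | false = countᵇ-split q p xs

countSubsets : ∀ {n} → (Subset n → Bool) → ℕ
countSubsets {n} p = countᵇ p (allSubsets n)

countSubsets-∷ : ∀ {n} (p : Subset (suc n) → Bool) →
  countSubsets p ≡ countSubsets (λ S → p (outside ∷ S)) + countSubsets (λ S → p (inside ∷ S))
countSubsets-∷ {n} p = trans (countᵇ-++ p (map (outside ∷_) (allSubsets n)) _)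
  (cong₂ _+_ (countᵇ-map p (outside ∷_) (allSubsets n)) (countᵇ-map p (inside ∷_) (allSubsets n)))

between : ∀ {n} → ℕ → Subset n → Subset n → Subset n → Bool
between k Y X S = S ⊆ᵇ X ∧ (Y ⊆ᵇ S ∧ (∣ S ∣ ≡ᵇ k))

≤⇒1+n≡ᵇm≡false : ∀ {m n} → m ≤ n → (suc n ≡ᵇ m) ≡ false
≤⇒1+n≡ᵇm≡false z≤n       = refl
≤⇒1+n≡ᵇm≡false (s≤s m≤n) = ≤⇒1+n≡ᵇm≡false m≤n

countSubsets-between : ∀ {n} (Y X : Subset n) → Y ⊆ᵇ X ≡ true → ∀ j →
  countSubsets (between (j + ∣ Y ∣) Y X) ≡ (∣ X ∣ ∸ ∣ Y ∣) C j
countSubsets-between []            []            _   zero    = refl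
countSubsets-between []            []            _   (suc j) = refl
countSubsets-between {suc n} (outside ∷ Y) (outside ∷ X) Y⊆X j = begin
  countSubsets (between (j + ∣ Y ∣) (outside ∷ Y) (outside ∷ X))
    ≡⟨ countSubsets-∷ (between (j + ∣ Y ∣) (outside ∷ Y) (outside ∷ X)) ⟩
  countSubsets (between (j + ∣ Y ∣) Y X) + countSubsets {n} (λ _ → false)
    ≡⟨ cong₂ _+_ (countSubsets-between Y X Y⊆X j) (countᵇ-none (λ _ → refl) (allSubsets n)) ⟩
  (∣ X ∣ ∸ ∣ Y ∣) C j + 0
    ≡⟨ +-identityʳ _ ⟩
  (∣ X ∣ ∸ ∣ Y ∣) C j ∎
  where open ≡-Reasoning
countSubsets-between {suc n} (inside ∷ Y)  (inside ∷ X)  Y⊆X j = begin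
  countSubsets (between (j + suc ∣ Y ∣) (inside ∷ Y) (inside ∷ X))
    ≡⟨ countSubsets-∷ (between (j + suc ∣ Y ∣) (inside ∷ Y) (inside ∷ X)) ⟩
  countSubsets (λ S → S ⊆ᵇ X ∧ false)
    + countSubsets (λ S → S ⊆ᵇ X ∧ (Y ⊆ᵇ S ∧ (suc ∣ S ∣ ≡ᵇ j + suc ∣ Y ∣)))
    ≡⟨ cong₂ _+_ (countᵇ-none (λ S → ∧-zeroʳ (S ⊆ᵇ X)) (allSubsets n))
                 (countᵇ-cong (λ S → cong (λ k → S ⊆ᵇ X ∧ (Y ⊆ᵇ S ∧ (suc ∣ S ∣ ≡ᵇ k))) (+-suc j ∣ Y ∣))
                              (allSubsets n)) ⟩
  countSubsets (between (j + ∣ Y ∣) Y X)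
    ≡⟨ countSubsets-between Y X Y⊆X j ⟩
  (∣ X ∣ ∸ ∣ Y ∣) C j ∎
  where open ≡-Reasoning
countSubsets-between {suc n} (outside ∷ Y) (inside ∷ X)  Y⊆X zero =
  trans (countSubsets-∷ (between ∣ Y ∣ (outside ∷ Y) (inside ∷ X)))
        (cong₂ _+_ (countSubsets-between Y X Y⊆X 0) (countᵇ-none too-small (allSubsets n)))
  where
  too-small : ∀ S → S ⊆ᵇ X ∧ (Y ⊆ᵇ S ∧ (suc ∣ S ∣ ≡ᵇ ∣ Y ∣)) ≡ false
  too-small S with Y ⊆ᵇ S in Y⊆S
  ... | false = ∧-zeroʳ (S ⊆ᵇ X)
  ... | true  rewrite ≤⇒1+n≡ᵇm≡false (⊆ᵇ⇒∣p∣≤∣q∣ {p = Y} Y⊆S) = ∧-zeroʳ (S ⊆ᵇ X)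
countSubsets-between {suc n} (outside ∷ Y) (inside ∷ X)  Y⊆X (suc j) = begin
  countSubsets (between (suc j + ∣ Y ∣) (outside ∷ Y) (inside ∷ X))
    ≡⟨ countSubsets-∷ (between (suc j + ∣ Y ∣) (outside ∷ Y) (inside ∷ X)) ⟩
  countSubsets (between (suc j + ∣ Y ∣) Y X) + countSubsets (between (j + ∣ Y ∣) Y X)
    ≡⟨ cong₂ _+_ (countSubsets-between Y X Y⊆X (suc j)) (countSubsets-between Y X Y⊆X j) ⟩
  d C suc j + d C j   ≡⟨ +-comm (d C suc j) (d C j) ⟩
  d C j + d C suc j   ≡⟨ nCk+nC[k+1]≡[n+1]C[k+1] d j ⟩
  suc d C suc j       ≡⟨ cong (_C suc j) (sym (+-∸-assoc 1 (⊆ᵇ⇒∣p∣≤∣q∣ {p = Y} Y⊆X))) ⟩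
  (suc ∣ X ∣ ∸ ∣ Y ∣) C suc j ∎
  where
  open ≡-Reasoning
  d = ∣ X ∣ ∸ ∣ Y ∣
countSubsets-between (inside ∷ Y)  (outside ∷ X) ()

countSubsets-between-⊈ : ∀ {n} k (Y X : Subset n) → Y ⊆ᵇ X ≡ false → countSubsets (between k Y X) ≡ 0
countSubsets-between-⊈ {n} k Y X Y⊈X = countᵇ-none empty (allSubsets n)
  where
  empty : ∀ S → between k Y X S ≡ false
  empty S with S ⊆ᵇ X in S⊆X | Y ⊆ᵇ S in Y⊆S
  ... | false | _     = refl
  ... | true  | false = refl
  ... | true  | true  with () ← trans (sym Y⊈X) (⊆ᵇ-trans {p = Y} Y⊆S S⊆X)

countSubsets-between′ : ∀ {n} {k j} (Y X : Subset n) → Y ⊆ᵇ X ≡ true → j + ∣ Y ∣ ≡ k →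
  countSubsets (between k Y X) ≡ (∣ X ∣ ∸ ∣ Y ∣) C j
countSubsets-between′ {j = j} Y X Y⊆X refl = countSubsets-between Y X Y⊆X j

countSubsets-triplesThrough : ∀ {n} (v : Fin n) → countSubsets (λ S → lookup S v ∧ (∣ S ∣ ≡ᵇ 3)) ≡ (n ∸ 1) C 2
countSubsets-triplesThrough {n} v = begin
  countSubsets (λ S → lookup S v ∧ (∣ S ∣ ≡ᵇ 3))
    ≡⟨ countᵇ-cong (λ S → cong₂ (λ a b → a ∧ (b ∧ (∣ S ∣ ≡ᵇ 3))) (sym (⊆ᵇ⊤ S)) (sym (⁅⁆⊆ᵇ v S)))
                   (allSubsets n) ⟩
  countSubsets (between 3 ⁅ v ⁆ ⊤)
    ≡⟨ countSubsets-between′ ⁅ v ⁆ ⊤ (⊆ᵇ⊤ ⁅ v ⁆) (cong (2 +_) (∣⁅x⁆∣≡1 v)) ⟩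
  (∣ ⊤ {n} ∣ ∸ ∣ ⁅ v ⁆ ∣) C 2
    ≡⟨ cong₂ (λ a b → (a ∸ b) C 2) (∣⊤∣≡n n) (∣⁅x⁆∣≡1 v) ⟩
  (n ∸ 1) C 2 ∎
  where open ≡-Reasoning

-- The space barrier and its degrees

∧-rearrange : ∀ a b c d → (a ∧ (b ∧ c)) ∧ d ≡ ((d ∧ c) ∧ a) ∧ b
∧-rearrange a b c d = prove 4 ((A ⊕ (B ⊕ C)) ⊕ D) (((D ⊕ C) ⊕ A) ⊕ B) (a ∷ b ∷ c ∷ d ∷ [])
  where
  open ∧-Solver ∧-idempotentCommutativeMonoid using (prove; var; _⊕_)
  A = var zero
  B = var (suc zero)
  C = var (suc (suc zero))
  D = var (suc (suc (suc zero)))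

1≤nC2 : ∀ {m} → 2 ≤ m → 1 ≤ m C 2
1≤nC2 {suc zero}    (s≤s ())
1≤nC2 {suc (suc k)} _ = begin
  1                              ≤⟨ s≤s z≤n ⟩
  suc k                          ≡⟨ nC1≡n (suc k) ⟨
  suc k C 1                      ≤⟨ m≤m+n _ _ ⟩
  suc k C 1 + suc k C 2          ≡⟨ nCk+nC[k+1]≡[n+1]C[k+1] (suc k) 1 ⟩
  suc (suc k) C 2                ∎
  where open ≤-Reasoning

module SpaceBarrier {n} (B : Subset n) (pairEdges : Bool) (x y : Fin n) where

  core : Subset n
  core = ⁅ y ⁆ [ x ]≔ inside

  isEdge : Subset n → Bool
  isEdge S = (∣ S ∣ ≡ᵇ 3) ∧ (not (S ⊆ᵇ B) ∨ pairEdges ∧ core ⊆ᵇ S)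

  H : Hypergraph3 n
  H = record
    { edge    = isEdge
    ; uniform = λ S isEdge-S → ≡ᵇ⇒≡ ∣ S ∣ 3 (Equivalence.from T-≡ (∧≡true⇒ˡ isEdge-S))
    }

  pairDegree crossingDegree : Fin n → ℕ
  pairDegree v     = countSubsets (λ S → between 3 (core [ v ]≔ inside) B S ∧ pairEdges)
  crossingDegree v = countSubsets (λ S → not (S ⊆ᵇ B) ∧ (lookup S v ∧ (∣ S ∣ ≡ᵇ 3)))

  degree≡pair+crossing : ∀ v → degree H v ≡ pairDegree v + crossingDegree v
  degree≡pair+crossing v = begin
    degree H v
      ≡⟨ length-filterᵇ _ (allSubsets n) ⟩
    countSubsets (λ S → isEdge S ∧ lookup S v)
      ≡⟨ countᵇ-split (_⊆ᵇ B) _ (allSubsets n) ⟩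
    countSubsets (λ S → S ⊆ᵇ B ∧ (isEdge S ∧ lookup S v))
      + countSubsets (λ S → not (S ⊆ᵇ B) ∧ (isEdge S ∧ lookup S v))
      ≡⟨ cong₂ _+_ (countᵇ-cong inside-B (allSubsets n)) (countᵇ-cong outside-B (allSubsets n)) ⟩
    pairDegree v + crossingDegree v ∎
    where
    open ≡-Reasoning
    inside-B : ∀ S → S ⊆ᵇ B ∧ (((∣ S ∣ ≡ᵇ 3) ∧ (not (S ⊆ᵇ B) ∨ pairEdges ∧ core ⊆ᵇ S)) ∧ lookup S v)
                   ≡ (S ⊆ᵇ B ∧ ((core [ v ]≔ inside) ⊆ᵇ S ∧ (∣ S ∣ ≡ᵇ 3))) ∧ pairEdges
    inside-B S rewrite []≔inside-⊆ᵇ v core S with S ⊆ᵇ B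
    ... | false = refl
    ... | true  = ∧-rearrange (∣ S ∣ ≡ᵇ 3) pairEdges (core ⊆ᵇ S) (lookup S v)
    outside-B : ∀ S → not (S ⊆ᵇ B) ∧ (((∣ S ∣ ≡ᵇ 3) ∧ (not (S ⊆ᵇ B) ∨ pairEdges ∧ core ⊆ᵇ S))
                                       ∧ lookup S v)
                    ≡ not (S ⊆ᵇ B) ∧ (lookup S v ∧ (∣ S ∣ ≡ᵇ 3))
    outside-B S with S ⊆ᵇ B
    ... | true  = refl
    ... | false = trans (cong (_∧ lookup S v) (∧-identityʳ (∣ S ∣ ≡ᵇ 3))) (∧-comm (∣ S ∣ ≡ᵇ 3) (lookup S v))

  triplesThrough-split : ∀ v →
    countSubsets (λ S → lookup S v ∧ (∣ S ∣ ≡ᵇ 3)) ≡ countSubsets (between 3 ⁅ v ⁆ B) + crossingDegree v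
  triplesThrough-split v = trans (countᵇ-split (_⊆ᵇ B) _ (allSubsets n))
    (cong (_+ crossingDegree v)
          (countᵇ-cong (λ S → cong (λ b → S ⊆ᵇ B ∧ (b ∧ (∣ S ∣ ≡ᵇ 3))) (sym (⁅⁆⊆ᵇ v S))) (allSubsets n)))

  crossingDegree-∈ : ∀ {v} → lookup B v ≡ true → (∣ B ∣ ∸ 1) C 2 + crossingDegree v ≡ (n ∸ 1) C 2
  crossingDegree-∈ {v} v∈B = begin
    (∣ B ∣ ∸ 1) C 2 + crossingDegree v
      ≡⟨ cong (_+ crossingDegree v) (trans (countSubsets-between′ ⁅ v ⁆ B ⁅v⁆⊆B (cong (2 +_) (∣⁅x⁆∣≡1 v)))
                                           (cong (λ b → (∣ B ∣ ∸ b) C 2) (∣⁅x⁆∣≡1 v))) ⟨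
    countSubsets (between 3 ⁅ v ⁆ B) + crossingDegree v
      ≡⟨ triplesThrough-split v ⟨
    countSubsets (λ S → lookup S v ∧ (∣ S ∣ ≡ᵇ 3))
      ≡⟨ countSubsets-triplesThrough v ⟩
    (n ∸ 1) C 2 ∎
    where
    open ≡-Reasoning
    ⁅v⁆⊆B : ⁅ v ⁆ ⊆ᵇ B ≡ true
    ⁅v⁆⊆B = trans (⁅⁆⊆ᵇ v B) v∈B

  crossingDegree-∉ : ∀ {v} → lookup B v ≡ false → crossingDegree v ≡ (n ∸ 1) C 2
  crossingDegree-∉ {v} v∉B = begin
    crossingDegree v
      ≡⟨ cong (_+ crossingDegree v) (countSubsets-between-⊈ 3 ⁅ v ⁆ B (trans (⁅⁆⊆ᵇ v B) v∉B)) ⟨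
    countSubsets (between 3 ⁅ v ⁆ B) + crossingDegree v
      ≡⟨ triplesThrough-split v ⟨
    countSubsets (λ S → lookup S v ∧ (∣ S ∣ ≡ᵇ 3))
      ≡⟨ countSubsets-triplesThrough v ⟩
    (n ∸ 1) C 2 ∎
    where open ≡-Reasoning

  baseDegree : ℕ
  baseDegree = (n ∸ 1) C 2 ∸ (∣ B ∣ ∸ 1) C 2

  crossingDegree≡baseDegree : ∀ {v} → lookup B v ≡ true → crossingDegree v ≡ baseDegree
  crossingDegree≡baseDegree {v} v∈B = trans (sym (m+n∸m≡n ((∣ B ∣ ∸ 1) C 2) (crossingDegree v)))
                                             (cong (_∸ (∣ B ∣ ∸ 1) C 2) (crossingDegree-∈ v∈B))

  baseDegree≤crossingDegree : ∀ v → baseDegree ≤ crossingDegree v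
  baseDegree≤crossingDegree v with lookup B v in v∈?B
  ... | true  = ≤-reflexive (sym (crossingDegree≡baseDegree v∈?B))
  ... | false = subst (baseDegree ≤_) (sym (crossingDegree-∉ v∈?B)) (m∸n≤m ((n ∸ 1) C 2) ((∣ B ∣ ∸ 1) C 2))

  degree-noPairs : pairEdges ≡ false → ∀ v → degree H v ≡ crossingDegree v
  degree-noPairs refl v = trans (degree≡pair+crossing v)
    (cong (_+ crossingDegree v) (countᵇ-none (λ S → ∧-zeroʳ (between 3 (core [ v ]≔ inside) B S)) (allSubsets n)))

  minDegree-noPairs : pairEdges ≡ false → ∀ {v₀} → lookup B v₀ ≡ true → MinDegreeIs H baseDegree
  minDegree-noPairs noPairs {v₀} v₀∈B =
    (λ v → subst (baseDegree ≤_) (sym (degree-noPairs noPairs v)) (baseDegree≤crossingDegree v)) ,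
    v₀ , trans (degree-noPairs noPairs v₀) (crossingDegree≡baseDegree v₀∈B)

  edge-⊆B⇒pair : ∀ {S} → isEdge S ≡ true → S ⊆ᵇ B ≡ true →
                 pairEdges ≡ true × lookup S x ≡ true × lookup S y ≡ true
  edge-⊆B⇒pair {S} isEdge-S S⊆B = ∧≡true⇒ˡ pair , ∧≡true⇒ˡ x∧y , trans (sym (⁅⁆⊆ᵇ y S)) (∧≡true⇒ʳ x∧y)
    where
    pair : pairEdges ∧ core ⊆ᵇ S ≡ true
    pair = ∧≡true⇒ʳ {∣ S ∣ ≡ᵇ 3}
             (subst (λ b → (∣ S ∣ ≡ᵇ 3) ∧ (not b ∨ pairEdges ∧ core ⊆ᵇ S) ≡ true) S⊆B isEdge-S)
    x∧y : lookup S x ∧ ⁅ y ⁆ ⊆ᵇ S ≡ true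
    x∧y = trans (sym ([]≔inside-⊆ᵇ x ⁅ y ⁆ S)) (∧≡true⇒ʳ pair)

  module _ (x≢y : x ≢ y) (x∈B : lookup B x ≡ true) (y∈B : lookup B y ≡ true) where

    ∣core∣ : ∣ core ∣ ≡ 2
    ∣core∣ = trans (∣[]≔inside∣ x ⁅ y ⁆)
                   (cong₂ (λ b c → if b then c else suc c) (lookup-⁅⁆-≢ x≢y) (∣⁅x⁆∣≡1 y))

    ∣core+v∣ : ∀ v → ∣ core [ v ]≔ inside ∣ ≡ (if lookup core v then 2 else 3)
    ∣core+v∣ v = trans (∣[]≔inside∣ v core) (cong (λ c → if lookup core v then c else suc c) ∣core∣)

    lookup-core-≢ : ∀ {v} → v ≢ x → v ≢ y → lookup core v ≡ false
    lookup-core-≢ v≢x v≢y = trans (lookup∘update′ v≢x ⁅ y ⁆ inside) (lookup-⁅⁆-≢ v≢y)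

    core+v⊆B : ∀ {v} → lookup B v ≡ true → (core [ v ]≔ inside) ⊆ᵇ B ≡ true
    core+v⊆B {v} v∈B
      rewrite []≔inside-⊆ᵇ v core B | []≔inside-⊆ᵇ x ⁅ y ⁆ B | ⁅⁆⊆ᵇ y B | v∈B | x∈B | y∈B = refl

    pairDegree-pairs : pairEdges ≡ true → ∀ v → pairDegree v ≡ countSubsets (between 3 (core [ v ]≔ inside) B)
    pairDegree-pairs refl v = countᵇ-cong (λ S → ∧-identityʳ (between 3 (core [ v ]≔ inside) B S)) (allSubsets n)

    pairDegree-∈core : pairEdges ≡ true → ∀ {v} → lookup B v ≡ true → lookup core v ≡ true →
                       pairDegree v ≡ ∣ B ∣ ∸ 2
    pairDegree-∈core pairs {v} v∈B v∈core = begin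
      pairDegree v                                      ≡⟨ pairDegree-pairs pairs v ⟩
      countSubsets (between 3 (core [ v ]≔ inside) B)
        ≡⟨ countSubsets-between′ {j = 1} (core [ v ]≔ inside) B (core+v⊆B v∈B) (cong suc ∣core+v∣≡2) ⟩
      (∣ B ∣ ∸ ∣ core [ v ]≔ inside ∣) C 1              ≡⟨ cong (λ c → (∣ B ∣ ∸ c) C 1) ∣core+v∣≡2 ⟩
      (∣ B ∣ ∸ 2) C 1                                   ≡⟨ nC1≡n (∣ B ∣ ∸ 2) ⟩
      ∣ B ∣ ∸ 2                                         ∎
      where
      open ≡-Reasoning
      ∣core+v∣≡2 : ∣ core [ v ]≔ inside ∣ ≡ 2
      ∣core+v∣≡2 = trans (∣core+v∣ v) (cong (λ b → if b then 2 else 3) v∈core)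

    pairDegree-∉core : pairEdges ≡ true → ∀ {v} → lookup B v ≡ true → lookup core v ≡ false → pairDegree v ≡ 1
    pairDegree-∉core pairs {v} v∈B v∉core = trans (pairDegree-pairs pairs v)
      (countSubsets-between′ {j = 0} (core [ v ]≔ inside) B (core+v⊆B v∈B)
                             (trans (∣core+v∣ v) (cong (λ b → if b then 2 else 3) v∉core)))

    3≤∣B∣ : ∀ {v} → lookup B v ≡ true → lookup core v ≡ false → 3 ≤ ∣ B ∣
    3≤∣B∣ {v} v∈B v∉core = subst (_≤ ∣ B ∣) (trans (∣core+v∣ v) (cong (λ b → if b then 2 else 3) v∉core))
      (⊆ᵇ⇒∣p∣≤∣q∣ {p = core [ v ]≔ inside} (core+v⊆B v∈B))

    1≤pairDegree : pairEdges ≡ true → 3 ≤ ∣ B ∣ → ∀ {v} → lookup B v ≡ true → 1 ≤ pairDegree v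
    1≤pairDegree pairs 3≤B {v} v∈B with lookup core v in v∈?core
    ... | true  = subst (1 ≤_) (sym (pairDegree-∈core pairs v∈B v∈?core)) (m<n⇒0<n∸m 3≤B)
    ... | false = ≤-reflexive (sym (pairDegree-∉core pairs v∈B v∈?core))

    baseDegree<[n-1]C2 : 3 ≤ ∣ B ∣ → baseDegree < (n ∸ 1) C 2
    baseDegree<[n-1]C2 3≤B = ∸-monoʳ-< {o = 0} (1≤nC2 (∸-monoˡ-≤ 1 3≤B))
                                          (subst ((∣ B ∣ ∸ 1) C 2 ≤_) (crossingDegree-∈ x∈B) (m≤m+n _ _))

    minDegree-pairs : pairEdges ≡ true → ∀ {v₀} → lookup B v₀ ≡ true → v₀ ≢ x → v₀ ≢ y →
                      MinDegreeIs H (suc baseDegree)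
    minDegree-pairs pairs {v₀} v₀∈B v₀≢x v₀≢y = lower , v₀ , degree-v₀
      where
      v₀∉core = lookup-core-≢ v₀≢x v₀≢y
      3≤B = 3≤∣B∣ v₀∈B v₀∉core
      lower : ∀ v → suc baseDegree ≤ degree H v
      lower v rewrite degree≡pair+crossing v with lookup B v in v∈?B
      ... | true  = subst (λ c → suc baseDegree ≤ pairDegree v + c) (sym (crossingDegree≡baseDegree v∈?B))
                      (+-monoˡ-≤ baseDegree (1≤pairDegree pairs 3≤B v∈?B))
      ... | false = ≤-trans (subst (baseDegree <_) (sym (crossingDegree-∉ v∈?B)) (baseDegree<[n-1]C2 3≤B)) (m≤n+m _ _)
      degree-v₀ : degree H v₀ ≡ suc baseDegree
      degree-v₀ = trans (degree≡pair+crossing v₀)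
        (cong₂ _+_ (pairDegree-∉core pairs v₀∈B v₀∉core) (crossingDegree≡baseDegree v₀∈B))

-- Positions on a loose cycle

data Slot : Set where
  first middle last : Slot

position : ℕ → Slot → ℕ
position i first  = 2 * i
position i middle = suc (2 * i)
position i last   = 2 * i + 2

CyclicSucc : ℕ → ℕ → ℕ → Set
CyclicSucc k i j = suc i ≡ j ⊎ (suc i ≡ k × j ≡ 0)

data Coincide (k : ℕ) : ℕ → Slot → ℕ → Slot → Set where
  same       : ∀ {i t} → Coincide k i t i t
  last≡first : ∀ {i j} → CyclicSucc k i j → Coincide k i last j first
  first≡last : ∀ {i j} → CyclicSucc k j i → Coincide k i first j last

2*i+2≡2*[1+i] : ∀ i → 2 * i + 2 ≡ 2 * suc i
2*i+2≡2*[1+i] i = trans (+-comm (2 * i) 2) (sym (*-suc 2 i))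

position-injective : ∀ {k i j} t t' → position i t ≡ position j t' → Coincide k i t j t'
position-injective {i = i} {j} first  first  eq with refl ← *-cancelˡ-≡ i j 2 eq = same
position-injective {i = i} {j} first  middle eq = ⊥-elim (even≢odd i j eq)
position-injective {i = i} {j} first  last   eq =
  first≡last (inj₁ (*-cancelˡ-≡ (suc j) i 2 (trans (sym (2*i+2≡2*[1+i] j)) (sym eq))))
position-injective {i = i} {j} middle first  eq = ⊥-elim (even≢odd j i (sym eq))
position-injective {i = i} {j} middle middle eq with refl ← *-cancelˡ-≡ i j 2 (suc-injective eq) = same
position-injective {i = i} {j} middle last   eq = ⊥-elim (even≢odd (suc j) i (trans (sym (2*i+2≡2*[1+i] j)) (sym eq)))
position-injective {i = i} {j} last   first  eq =
  last≡first (inj₁ (*-cancelˡ-≡ (suc i) j 2 (trans (sym (2*i+2≡2*[1+i] i)) eq)))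
position-injective {i = i} {j} last   middle eq = ⊥-elim (even≢odd (suc i) j (trans (sym (2*i+2≡2*[1+i] i)) eq))
position-injective {i = i} {j} last   last   eq with refl ← *-cancelˡ-≡ i j 2 (+-cancelʳ-≡ 2 (2 * i) (2 * j) eq) = same

position≡0 : ∀ {i} t → position i t ≡ 0 → t ≡ first × i ≡ 0
position≡0 {zero} first _ = refl , refl
position≡0 {i}    last  eq = ⊥-elim (1+n≢0 (trans (sym (+-suc (2 * i) 1)) eq))

position-mod : ∀ {n k i} .{{_ : NonZero n}} → n ≡ 2 * k → i < k → ∀ t →
  position i t % n ≡ position i t ⊎ (t ≡ last × suc i ≡ k × position i t % n ≡ 0)
position-mod refl i<k first  = inj₁ (m<n⇒m%n≡m (*-monoʳ-< 2 i<k))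
position-mod {k = k} {i} refl i<k middle = inj₁ (m<n⇒m%n≡m (subst (_≤ 2 * k) (*-suc 2 i) (*-monoʳ-≤ 2 i<k)))
position-mod {k = k} {i} refl i<k last with m≤n⇒m<n∨m≡n i<k
... | inj₁ 1+i<k = inj₁ (m<n⇒m%n≡m (subst (_< 2 * k) (sym (2*i+2≡2*[1+i] i)) (*-monoʳ-< 2 1+i<k)))
... | inj₂ 1+i≡k =
  inj₂ (refl , 1+i≡k , trans (cong (_% (2 * k)) (trans (2*i+2≡2*[1+i] i) (cong (2 *_) 1+i≡k))) (n%n≡0 (2 * k)))

position-mod-injective : ∀ {n k i j} .{{_ : NonZero n}} → n ≡ 2 * k → i < k → j < k → ∀ t t' →
  position i t % n ≡ position j t' % n → Coincide k i t j t'
position-mod-injective n≡2k i<k j<k t t' eq with position-mod n≡2k i<k t | position-mod n≡2k j<k t'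
... | inj₁ i-fixed | inj₁ j-fixed = position-injective t t' (trans (sym i-fixed) (trans eq j-fixed))
... | inj₁ i-fixed | inj₂ (refl , 1+j≡k , j-wraps) with position≡0 t (trans (sym i-fixed) (trans eq j-wraps))
...   | refl , refl = first≡last (inj₂ (1+j≡k , refl))
position-mod-injective n≡2k i<k j<k t t' eq | inj₂ (refl , 1+i≡k , i-wraps) | inj₁ j-fixed
  with position≡0 t' (trans (sym j-fixed) (trans (sym eq) i-wraps))
... | refl , refl = last≡first (inj₂ (1+i≡k , refl))
position-mod-injective n≡2k i<k j<k t t' eq | inj₂ (refl , 1+i≡k , _) | inj₂ (refl , 1+j≡k , _)
  with refl ← suc-injective (trans 1+i≡k (sym 1+j≡k)) = same

module LooseCycle {n} .{{_ : NonZero n}} (σ : Fin n → Fin n) (σ-injective : Injective _≡_ _≡_ σ)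
                  {k} (n≡2k : n ≡ 2 * k) where

  vertexAt-injective : ∀ {p q} → vertexAt σ p ≡ vertexAt σ q → p % n ≡ q % n
  vertexAt-injective eq = trans (sym (toℕ-fromℕ< _)) (trans (cong toℕ (σ-injective eq)) (toℕ-fromℕ< _))

  vertexAt-cong : ∀ {p q} → p % n ≡ q % n → vertexAt σ p ≡ vertexAt σ q
  vertexAt-cong eq = cong σ (toℕ-injective (trans (toℕ-fromℕ< _) (trans eq (sym (toℕ-fromℕ< _)))))

  shared-vertex : ∀ {i j} → i < k → j < k → ∀ t t' →
    vertexAt σ (position i t) ≡ vertexAt σ (position j t') → Coincide k i t j t'
  shared-vertex i<k j<k t t' eq = position-mod-injective n≡2k i<k j<k t t' (vertexAt-injective eq)

  lookup-tripleAt⁻ : ∀ i {w} → lookup (tripleAt σ i) w ≡ true → ∃[ t ] vertexAt σ (position i t) ≡ w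
  lookup-tripleAt⁻ i {w} e∋w with lookup-∪⁻ ⁅ vertexAt σ (position i first) ⁆ _ w e∋w
  ... | inj₁ first∋w = first , lookup-⁅⁆⇒≡ first∋w
  ... | inj₂ rest∋w with lookup-∪⁻ ⁅ vertexAt σ (position i middle) ⁆ _ w rest∋w
  ...   | inj₁ middle∋w = middle , lookup-⁅⁆⇒≡ middle∋w
  ...   | inj₂ last∋w   = last , lookup-⁅⁆⇒≡ last∋w

  tripleAt-period : tripleAt σ k ≡ tripleAt σ 0
  tripleAt-period =
    cong₂ _∪_ (cong ⁅_⁆ (shift 0))
              (cong₂ _∪_ (cong ⁅_⁆ (shift 1)) (cong ⁅_⁆ (trans (cong (vertexAt σ) (+-comm (2 * k) 2)) (shift 2))))
    where
    shift : ∀ r → vertexAt σ (r + 2 * k) ≡ vertexAt σ r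
    shift r = vertexAt-cong (trans (cong (λ m → (r + m) % n) (sym n≡2k)) ([m+n]%n≡m%n r n))

  tripleAt-succ : ∀ {i j} → CyclicSucc k i j → tripleAt σ (suc i) ≡ tripleAt σ j
  tripleAt-succ (inj₁ refl)         = refl
  tripleAt-succ (inj₂ (1+i≡k , refl)) = trans (cong (tripleAt σ) 1+i≡k) tripleAt-period

  module _ (loose : ∀ i → i < k → ∣ tripleAt σ i ∩ tripleAt σ (suc i) ∣ ≡ 1) where

    consecutive-share-one : ∀ {i j u w} → i < k → CyclicSucc k i j →
      lookup (tripleAt σ i) u ≡ true → lookup (tripleAt σ i) w ≡ true →
      lookup (tripleAt σ j) u ≡ true → lookup (tripleAt σ j) w ≡ true → u ≡ w
    consecutive-share-one {i} {j} {u} {w} i<k i→j eᵢ∋u eᵢ∋w eⱼ∋u eⱼ∋w with u Data.Fin.≟ w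
    ... | yes u≡w = u≡w
    ... | no  u≢w = ⊥-elim (1+n≰n (subst (2 ≤_) (loose i i<k)
                      (2≤∣p∣ {p = eᵢ ∩ eᵢ₊₁} (lookup-∩⁺ eᵢ eᵢ₊₁ u eᵢ∋u (next∋ eⱼ∋u))
                                             (lookup-∩⁺ eᵢ eᵢ₊₁ w eᵢ∋w (next∋ eⱼ∋w)) u≢w)))
      where
      eᵢ = tripleAt σ i
      eᵢ₊₁ = tripleAt σ (suc i)
      next∋ : ∀ {v} → lookup (tripleAt σ j) v ≡ true → lookup eᵢ₊₁ v ≡ true
      next∋ {v} = subst (λ e → lookup e v ≡ true) (sym (tripleAt-succ i→j))

-- The space barrier has no loose Hamilton cycle

lastBit : Slot → ℕ
lastBit first  = 0
lastBit middle = 0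
lastBit last   = 1

lastBit≤1 : ∀ t → lastBit t ≤ 1
lastBit≤1 first  = z≤n
lastBit≤1 middle = z≤n
lastBit≤1 last   = s≤s z≤n

bit+2*n-injective : ∀ {b b' m m'} → b ≤ 1 → b' ≤ 1 → b + 2 * m ≡ b' + 2 * m' → b ≡ b' × m ≡ m'
bit+2*n-injective {0} {0} {m} {m'} _ _ eq = refl , *-cancelˡ-≡ m m' 2 eq
bit+2*n-injective {0} {1} {m} {m'} _ _ eq = ⊥-elim (even≢odd m m' eq)
bit+2*n-injective {1} {0} {m} {m'} _ _ eq = ⊥-elim (even≢odd m' m (sym eq))
bit+2*n-injective {1} {1} {m} {m'} _ _ eq = refl , *-cancelˡ-≡ m m' 2 (suc-injective eq)
bit+2*n-injective {suc (suc _)} (s≤s ()) _ _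
bit+2*n-injective {_} {suc (suc _)} _ (s≤s ()) _

bit+2*n<2*a : ∀ {b m a} → b ≤ 1 → m < a → b + 2 * m < 2 * a
bit+2*n<2*a {b} {m} {a} b≤1 m<a = begin-strict
  b + 2 * m   ≤⟨ +-monoˡ-≤ (2 * m) b≤1 ⟩
  1 + 2 * m   <⟨ n<1+n _ ⟩
  2 + 2 * m   ≡⟨ *-suc 2 m ⟨
  2 * suc m   ≤⟨ *-monoʳ-≤ 2 m<a ⟩
  2 * a       ∎
  where open ≤-Reasoning

module SpaceBarrierCycle {n} .{{_ : NonZero n}} (a : ℕ) (pairEdges : Bool) {x y : Fin n} (x≢y : x ≢ y)
  (σ : Fin n → Fin n) (σ-injective : Injective _≡_ _≡_ σ) {k} (n≡2k : n ≡ 2 * k) where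

  open SpaceBarrier (finalSegment n a) pairEdges x y
  open LooseCycle σ σ-injective {k} n≡2k

  labels : ℕ
  labels = 2 * a + (if pairEdges then 1 else 0)

  crossing<labels : ∀ t {u : Fin n} → toℕ u < a → lastBit t + 2 * toℕ u < labels
  crossing<labels t u<a = ≤-trans (bit+2*n<2*a (lastBit≤1 t) u<a) (m≤m+n (2 * a) _)

  -- A label below 2a encodes a vertex u < a of the triple and whether u is its last vertex;
  -- the label 2a is left for a triple inside B, which must then contain x and y.
  data Label (i c : ℕ) : Set where
    crossing : ∀ t → toℕ (vertexAt σ (position i t)) < a →
               c ≡ lastBit t + 2 * toℕ (vertexAt σ (position i t)) → Label i c
    pair     : c ≡ 2 * a → lookup (tripleAt σ i) x ≡ true → lookup (tripleAt σ i) y ≡ true → Label i c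

  module _ (edges : ∀ i → i < k → isEdge (tripleAt σ i) ≡ true) where

    label-exists : ∀ {i} → i < k → Σ[ c ∈ ℕ ] c < labels × Label i c
    label-exists {i} i<k with toℕ (vertexAt σ (position i first)) <? a
                            | toℕ (vertexAt σ (position i middle)) <? a
                            | toℕ (vertexAt σ (position i last)) <? a
    ... | yes u<a | _       | _       = _ , crossing<labels first u<a , crossing first u<a refl
    ... | no _    | yes u<a | _       = _ , crossing<labels middle u<a , crossing middle u<a refl
    ... | no _    | no _    | yes u<a = _ , crossing<labels last u<a , crossing last u<a refl
    ... | no u≮a  | no v≮a  | no w≮a  with edge-⊆B⇒pair {tripleAt σ i} (edges i i<k) e⊆B
      where
      a≤ : ∀ t → a ≤ toℕ (vertexAt σ (position i t))
      a≤ first  = ≮⇒≥ u≮a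
      a≤ middle = ≮⇒≥ v≮a
      a≤ last   = ≮⇒≥ w≮a
      e⊆B : tripleAt σ i ⊆ᵇ finalSegment n a ≡ true
      e⊆B = lookup⇒⊆ᵇ (tripleAt σ i) _ λ w e∋w →
        let t , vₜ≡w = lookup-tripleAt⁻ i e∋w in lookup-finalSegment w (subst (λ v → a ≤ toℕ v) vₜ≡w (a≤ t))
    ...   | refl , e∋x , e∋y = 2 * a , m<m+n (2 * a) (s≤s z≤n) , pair refl e∋x e∋y

  module _ (loose : ∀ i → i < k → ∣ tripleAt σ i ∩ tripleAt σ (suc i) ∣ ≡ 1) where

    label-injective : ∀ {i j c} → i < k → j < k → Label i c → Label j c → i ≡ j
    label-injective i<k j<k (crossing t _ c≡) (crossing t' _ c≡')
      with bit+2*n-injective (lastBit≤1 t) (lastBit≤1 t') (trans (sym c≡) c≡')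
    ... | same-bit , same-vertex with shared-vertex i<k j<k t t' (toℕ-injective same-vertex)
    ...   | same         = refl
    ...   | last≡first _ with () ← same-bit
    ...   | first≡last _ with () ← same-bit
    label-injective _ _ (crossing t u<a c≡) (pair c≡2a _ _) =
      ⊥-elim (<⇒≢ (bit+2*n<2*a (lastBit≤1 t) u<a) (trans (sym c≡) c≡2a))
    label-injective _ _ (pair c≡2a _ _) (crossing t u<a c≡) =
      ⊥-elim (<⇒≢ (bit+2*n<2*a (lastBit≤1 t) u<a) (trans (sym c≡) c≡2a))
    label-injective {i} {j} i<k j<k (pair _ eᵢ∋x eᵢ∋y) (pair _ eⱼ∋x eⱼ∋y)
      with lookup-tripleAt⁻ i eᵢ∋x | lookup-tripleAt⁻ j eⱼ∋x
    ... | t , vₜ≡x | t' , vₜ'≡x with shared-vertex i<k j<k t t' (trans vₜ≡x (sym vₜ'≡x))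
    ...   | same            = refl
    ...   | last≡first i→j = ⊥-elim (x≢y (consecutive-share-one loose i<k i→j eᵢ∋x eᵢ∋y eⱼ∋x eⱼ∋y))
    ...   | first≡last j→i = ⊥-elim (x≢y (consecutive-share-one loose j<k j→i eⱼ∋x eⱼ∋y eᵢ∋x eᵢ∋y))

  k≤labels : (∀ i → i < k → isEdge (tripleAt σ i) ≡ true) →
             (∀ i → i < k → ∣ tripleAt σ i ∩ tripleAt σ (suc i) ∣ ≡ 1) → k ≤ labels
  k≤labels edges loose = ≮⇒≥ λ labels<k →
    let i , j , i<j , same-label = pigeonhole labels<k label
        cᵢ≡cⱼ = fromℕ<-injective _ _ (proj₁ (proj₂ (labelOf i))) (proj₁ (proj₂ (labelOf j))) same-label
    in <⇒≢ i<j (label-injective loose (toℕ<n i) (toℕ<n j) (proj₂ (proj₂ (labelOf i)))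
                 (subst (Label (toℕ j)) (sym cᵢ≡cⱼ) (proj₂ (proj₂ (labelOf j)))))
    where
    labelOf : (i : Fin k) → Σ[ c ∈ ℕ ] c < labels × Label (toℕ i) c
    labelOf i = label-exists edges (toℕ<n i)
    label : Fin k → Fin labels
    label i = fromℕ< (proj₁ (proj₂ (labelOf i)))

spaceBarrier-noLooseHamiltonCycle : ∀ {n} .{{_ : NonZero n}} a pairEdges {x y : Fin n} → x ≢ y →
  (∀ k → n ≡ 2 * k → 2 * a + (if pairEdges then 1 else 0) < k) →
  ¬ LooseHamiltonCycle (SpaceBarrier.H (finalSegment n a) pairEdges x y)
spaceBarrier-noLooseHamiltonCycle a pairEdges x≢y labels<k (σ , (σ-injective , _) , k , n≡2k , edges , loose) =
  <⇒≱ (labels<k k n≡2k) (SpaceBarrierCycle.k≤labels a pairEdges x≢y σ σ-injective n≡2k edges loose)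

-- The two residues of n modulo 4

targetDegree≡ : ∀ n {b c} → (3 * n) / 4 ≡ b → cConst n ≡ suc c → targetDegree n ≡ ((n ∸ 1) C 2 ∸ b C 2) + c
targetDegree≡ n refl c≡1+c rewrite c≡1+c = +-∸-assoc ((n ∸ 1) C 2 ∸ ((3 * n) / 4) C 2) (s≤s z≤n)

Extremal : (n : ℕ) .{{_ : NonZero n}} → Set
Extremal n = Σ (Hypergraph3 n) λ H → MinDegreeIs H (targetDegree n) × ¬ LooseHamiltonCycle H

Extremal-cong : ∀ {m n} .{{_ : NonZero m}} .{{_ : NonZero n}} → m ≡ n → Extremal m → Extremal n
Extremal-cong refl extremal = extremal

extremal-4m+2 : ∀ m → Extremal (2 + 4 * m)
extremal-4m+2 m = H , subst (MinDegreeIs H) (sym target≡base) (minDegree-noPairs refl v₀∈B) ,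
                  spaceBarrier-noLooseHamiltonCycle m false {zero} {suc zero} (λ ()) labels<k
  where
  n = 2 + 4 * m
  open SpaceBarrier (finalSegment n m) false zero (suc zero)
  m<n : m < n
  m<n = s≤s (m≤n⇒m≤1+n (m≤n*m m 4))
  v₀∈B : lookup (finalSegment n m) (fromℕ< m<n) ≡ true
  v₀∈B = lookup-finalSegment (fromℕ< m<n) (≤-reflexive (sym (toℕ-fromℕ< m<n)))
  labels<k : ∀ k → n ≡ 2 * k → 2 * m + 0 < k
  labels<k k n≡2k = subst (2 * m + 0 <_) (*-cancelˡ-≡ (1 + 2 * m) k 2 (trans (sym (n≡2[1+2m] m)) n≡2k))
                       (s≤s (≤-reflexive (+-identityʳ (2 * m))))
    where
    n≡2[1+2m] : ∀ m → 2 + 4 * m ≡ 2 * (1 + 2 * m)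
    n≡2[1+2m] = solve-∀
  ∣B∣∸1 : ∣ finalSegment n m ∣ ∸ 1 ≡ 1 + 3 * m
  ∣B∣∸1 = cong (_∸ 1) (trans (∣finalSegment∣ n m) (trans (cong (_∸ m) (n≡m+∣B∣ m)) (m+n∸m≡n m _)))
    where
    n≡m+∣B∣ : ∀ m → 2 + 4 * m ≡ m + (2 + 3 * m)
    n≡m+∣B∣ = solve-∀
  ⌊3n/4⌋ : (3 * n) / 4 ≡ 1 + 3 * m
  ⌊3n/4⌋ = trans (/-congˡ {o = 4} (3n≡2+[1+3m]*4 m))
                 (trans (+-distrib-/-∣ʳ 2 {d = 4} (n∣m*n (1 + 3 * m))) (m*n/n≡m (1 + 3 * m) 4))
    where
    3n≡2+[1+3m]*4 : ∀ m → 3 * (2 + 4 * m) ≡ 2 + (1 + 3 * m) * 4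
    3n≡2+[1+3m]*4 = solve-∀
  n%4≡2 : n % 4 ≡ 2
  n%4≡2 = trans (%-congˡ {o = 4} (cong (2 +_) (*-comm 4 m))) ([m+kn]%n≡m%n 2 m 4)
  target≡base : targetDegree n ≡ baseDegree
  target≡base = trans (targetDegree≡ n (trans ⌊3n/4⌋ (sym ∣B∣∸1)) (cong (λ r → if r ≡ᵇ 0 then 2 else 1) n%4≡2))
                      (+-identityʳ baseDegree)

extremal-4m+4 : ∀ m → Extremal (4 + 4 * m)
extremal-4m+4 m = H ,
                  subst (MinDegreeIs H) (sym target≡1+base) (minDegree-pairs x≢y (∈B _) (∈B _) refl (∈B _) v₀≢x v₀≢y) ,
                  spaceBarrier-noLooseHamiltonCycle m true x≢y labels<k
  where
  n = 4 + 4 * m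
  j+m<n : ∀ (j : Fin 3) → toℕ j + m < n
  j+m<n j = ≤-trans (s≤s (+-monoˡ-≤ m (s≤s⁻¹ (toℕ<n j)))) (s≤s (s≤s (s≤s (m≤n⇒m≤1+n (m≤n*m m 4)))))
  vertex : Fin 3 → Fin n
  vertex j = fromℕ< (j+m<n j)
  x y v₀ : Fin n
  x  = vertex zero
  y  = vertex (suc zero)
  v₀ = vertex (suc (suc zero))
  open SpaceBarrier (finalSegment n m) true x y
  vertex-injective : ∀ {i j} → vertex i ≡ vertex j → i ≡ j
  vertex-injective {i} {j} eq = toℕ-injective (+-cancelʳ-≡ m (toℕ i) (toℕ j)
    (trans (sym (toℕ-fromℕ< (j+m<n i))) (trans (cong toℕ eq) (toℕ-fromℕ< (j+m<n j)))))
  x≢y : x ≢ y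
  x≢y eq with () ← vertex-injective eq
  v₀≢x : v₀ ≢ x
  v₀≢x eq with () ← vertex-injective eq
  v₀≢y : v₀ ≢ y
  v₀≢y eq with () ← vertex-injective eq
  ∈B : ∀ j → lookup (finalSegment n m) (vertex j) ≡ true
  ∈B j = lookup-finalSegment (vertex j) (subst (m ≤_) (sym (toℕ-fromℕ< (j+m<n j))) (m≤n+m m (toℕ j)))
  labels<k : ∀ k → n ≡ 2 * k → 2 * m + 1 < k
  labels<k k n≡2k = subst (2 * m + 1 <_) (*-cancelˡ-≡ (2 + 2 * m) k 2 (trans (sym (n≡2[2+2m] m)) n≡2k))
                       (s≤s (≤-reflexive (+-comm (2 * m) 1)))
    where
    n≡2[2+2m] : ∀ m → 4 + 4 * m ≡ 2 * (2 + 2 * m)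
    n≡2[2+2m] = solve-∀
  ∣B∣∸1 : ∣ finalSegment n m ∣ ∸ 1 ≡ 3 + 3 * m
  ∣B∣∸1 = cong (_∸ 1) (trans (∣finalSegment∣ n m) (trans (cong (_∸ m) (n≡m+∣B∣ m)) (m+n∸m≡n m _)))
    where
    n≡m+∣B∣ : ∀ m → 4 + 4 * m ≡ m + (4 + 3 * m)
    n≡m+∣B∣ = solve-∀
  ⌊3n/4⌋ : (3 * n) / 4 ≡ 3 + 3 * m
  ⌊3n/4⌋ = trans (/-congˡ {o = 4} (3n≡[3+3m]*4 m)) (m*n/n≡m (3 + 3 * m) 4)
    where
    3n≡[3+3m]*4 : ∀ m → 3 * (4 + 4 * m) ≡ (3 + 3 * m) * 4
    3n≡[3+3m]*4 = solve-∀
  n%4≡0 : n % 4 ≡ 0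
  n%4≡0 = trans (%-congˡ {o = 4} (cong (4 +_) (*-comm 4 m))) (m*n%n≡0 (1 + m) 4)
  target≡1+base : targetDegree n ≡ suc baseDegree
  target≡1+base = trans (targetDegree≡ n (trans ⌊3n/4⌋ (sym ∣B∣∸1)) (cong (λ r → if r ≡ᵇ 0 then 2 else 1) n%4≡0))
                        (+-comm baseDegree 1)

even-or-odd : ∀ q → (∃[ m ] q ≡ 2 * m) ⊎ (∃[ m ] q ≡ 1 + 2 * m)
even-or-odd zero    = inj₁ (0 , refl)
even-or-odd (suc q) with even-or-odd q
... | inj₁ (m , refl) = inj₂ (m , refl)
... | inj₂ (m , refl) = inj₁ (suc m , cong suc (sym (+-suc m (m + 0))))

proposition1p3 : (n : ℕ) → .{{_ : NonZero n}} → 2 ∣ n →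
    Σ (Hypergraph3 n) λ H → MinDegreeIs H (targetDegree n) × ¬ LooseHamiltonCycle H
proposition1p3 n (divides q n≡q*2) with even-or-odd q
... | inj₁ (zero , refl)  = ⊥-elim (≢-nonZero⁻¹ n n≡q*2)
... | inj₁ (suc m , refl) = Extremal-cong (sym (trans n≡q*2 (q*2≡4+4m m))) (extremal-4m+4 m)
  where
  q*2≡4+4m : ∀ m → 2 * (1 + m) * 2 ≡ 4 + 4 * m
  q*2≡4+4m = solve-∀
... | inj₂ (m , refl)     = Extremal-cong (sym (trans n≡q*2 (q*2≡2+4m m))) (extremal-4m+2 m)
  where
  q*2≡2+4m : ∀ m → (1 + 2 * m) * 2 ≡ 2 + 4 * m
  q*2≡2+4m = solve-∀
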